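{- Let $U$ be a linear operator on $\mathbb K[x]$, let $Q$ be a delta operator with umbral operator $\phi$. Suppose that, as formal power series in $x,t$, \[ \frac{G_{U\phi}(x,t)}{G_\phi(x,t)}=\sum_{k=0}^\infty f_k(x)g_k(t) \] for some formal power series $(f_k)_{k\in\mathbb N}$, $(g_k)_{k\in\mathbb N}$. Then $U=\sum_{k=0}^\infty f_k(\hat x)\,g_k(Q)$.
   Context: $\mathbb K$ is a field of characteristic zero; $\hat x$ is multiplication by $x$, $D=d/dx$; shift-invariant operators (commuting with all shifts $f(x)\mapsto f(x+a)$) are formal power series in $D$. A delta operator is a shift-invariant $Q$ with $Qx$ a nonzero constant; its umbral operator $\phi$ is given by $\phi x^n=\phi_n(x)$ where $(\phi_n)$ is the unique polynomial sequence with $\deg\phi_n=n$, $\phi_0=1$, $\phi_n(0)=0$ ($n\ge1$), $Q\phi_n=n\phi_{n-1}$. For a linear operator $\psi$ on $\mathbb K[x]$, its exponential generating function is $G_\psi(x,t)=\sum_{n\ge0}(\psi x^n)\frac{t^n}{n!}$. (One has $G_\phi(x,t)=e^{x\tilde Q^{ -1}(t)}$ with $\tilde Q$ the power series such that $Q=\tilde Q(D)$, so it is invertible.) -}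

module Defs where

open import Level using (_⊔_)
open import Data.Nat using (ℕ; zero; suc; _≤_; _<_; _∸_; NonZero; s≤s)
open import Data.Nat.Properties using (_!≢0)
open import Data.Nat using (_!)
open import Data.Nat.Combinatorics using (_C_)
open import Data.Product using (Σ; ∃; _×_; _,_; proj₁; proj₂)
open import Relation.Nullary using (¬_)
open import Algebra.Bundles using (CommutativeRing)

ιR : ∀ {c ℓ} (R : CommutativeRing c ℓ) → ℕ → CommutativeRing.Carrier R
ιR R zero    = CommutativeRing.0# R
ιR R (suc n) = CommutativeRing._+_ R (CommutativeRing.1# R) (ιR R n)

record CharZeroField c ℓ : Set (Level.suc (c ⊔ ℓ)) where
  field
    cring : CommutativeRing c ℓ
  open CommutativeRing cring public
  field
    1≉0     : ¬ (1# ≈ 0#)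
    inv     : (a : Carrier) → ¬ (a ≈ 0#) → Carrier
    inv-r   : (a : Carrier) (a≉0 : ¬ (a ≈ 0#)) → a * inv a a≉0 ≈ 1#
    charZero : (n : ℕ) → .{{NonZero n}} → ¬ (ιR cring n ≈ 0#)

  ι : ℕ → Carrier
  ι = ιR cring

module Ops {c ℓ} (𝕂 : CharZeroField c ℓ) where
  open CharZeroField 𝕂

  sumTo : ℕ → (ℕ → Carrier) → Carrier
  sumTo zero    a = 0#
  sumTo (suc n) a = sumTo n a + a n

  pow : Carrier → ℕ → Carrier
  pow a zero    = 1#
  pow a (suc n) = a * pow a n

  invFact : ℕ → Carrier
  invFact n = inv (ι (n !)) (charZero (n !) {{n !≢0}})

  FPS : Set c
  FPS = ℕ → Carrier

  FPS₂ : Set c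
  FPS₂ = ℕ → ℕ → Carrier      -- F i j = coefficient of x^i t^j

  _≈₁_ : FPS → FPS → Set ℓ
  f ≈₁ g = ∀ i → f i ≈ g i

  _≈₂_ : FPS₂ → FPS₂ → Set ℓ
  F ≈₂ G = ∀ i j → F i j ≈ G i j

  _·₁_ : FPS → FPS → FPS
  (f ·₁ g) i = sumTo (suc i) (λ a → f a * g (i ∸ a))

  _·₂_ : FPS₂ → FPS₂ → FPS₂
  (F ·₂ G) i j =
    sumTo (suc i) (λ a → sumTo (suc j) (λ b → F a b * G (i ∸ a) (j ∸ b)))

  _⊗_ : FPS → FPS → FPS₂
  (f ⊗ g) i j = f i * g j

  -- Summation of a countable family of series in the formal
  -- ((x)- resp. (x,t)-adic) topology: for each coefficient only finitely
  -- many members contribute, and the sum has the resulting coefficient.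
  HasSum₁ : (ℕ → FPS) → FPS → Set ℓ
  HasSum₁ F S = ∀ i → ∃ λ K →
    (∀ k → K ≤ k → F k i ≈ 0#) × (S i ≈ sumTo K (λ k → F k i))

  HasSum₂ : (ℕ → FPS₂) → FPS₂ → Set ℓ
  HasSum₂ F S = ∀ i j → ∃ λ K →
    (∀ k → K ≤ k → F k i j ≈ 0#) × (S i j ≈ sumTo K (λ k → F k i j))

  Poly : Set (c ⊔ ℓ)
  Poly = Σ FPS λ a → ∃ λ N → ∀ i → N ≤ i → a i ≈ 0#

  coeff : Poly → FPS
  coeff = proj₁

  bound : Poly → ℕ
  bound p = proj₁ (proj₂ p)

  _≈ₚ_ : Poly → Poly → Set ℓ
  p ≈ₚ q = coeff p ≈₁ coeff q

  δ : ℕ → ℕ → Carrier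
  δ zero    zero    = 1#
  δ zero    (suc i) = 0#
  δ (suc n) zero    = 0#
  δ (suc n) (suc i) = δ n i

  mono : ℕ → Poly
  mono n = δ n , suc n , bnd n
    where
    bnd : ∀ n i → suc n ≤ i → δ n i ≈ 0#
    bnd zero    (suc i) _ = refl
    bnd (suc n) (suc i) (s≤s le) = bnd n i le

  record LinOp : Set (c ⊔ ℓ) where
    field
      app   : Poly → Poly
      cong  : ∀ p q → p ≈ₚ q → app p ≈ₚ app q
      additive : ∀ p q r → (∀ i → coeff r i ≈ coeff p i + coeff q i) →
                 ∀ i → coeff (app r) i ≈ coeff (app p) i + coeff (app q) i
      homog : ∀ (a : Carrier) p q → (∀ i → coeff q i ≈ a * coeff p i) →
              ∀ i → coeff (app q) i ≈ a * coeff (app p) i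
  open LinOp public

  iter : LinOp → ℕ → Poly → Poly
  iter Q zero    p = p
  iter Q (suc j) p = app Q (iter Q j p)

  -- the shift operator  f(x) ↦ f(x + a), on coefficients:
  -- [x^i] p(x + a) = Σ_j C(j,i) a^(j-i) p_j
  shiftC : Carrier → Poly → FPS
  shiftC a p i = sumTo (bound p) (λ j → ι (j C i) * pow a (j ∸ i) * coeff p j)

  ShiftInvariant : LinOp → Set (c ⊔ ℓ)
  ShiftInvariant Q = ∀ (a : Carrier) (p q : Poly) → coeff q ≈₁ shiftC a p →
    coeff (app Q q) ≈₁ shiftC a (app Q p)

  IsDelta : LinOp → Set (c ⊔ ℓ)
  IsDelta Q = ShiftInvariant Q ×
    (∃ λ (b : Carrier) → ¬ (b ≈ 0#) ×
       (coeff (app Q (mono 1)) 0 ≈ b) ×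
       (∀ i → 1 ≤ i → coeff (app Q (mono 1)) i ≈ 0#))

  IsUmbralOf : LinOp → LinOp → Set ℓ
  IsUmbralOf φ Q =
    (∀ n → ¬ (coeff (app φ (mono n)) n ≈ 0#)) ×
    (∀ n i → n < i → coeff (app φ (mono n)) i ≈ 0#) ×
    (app φ (mono 0) ≈ₚ mono 0) ×
    (∀ n → 1 ≤ n → coeff (app φ (mono n)) 0 ≈ 0#) ×
    (∀ n i → coeff (app Q (app φ (mono (suc n)))) i
               ≈ ι (suc n) * coeff (app φ (mono n)) i)

  _∘ₒ_ : LinOp → LinOp → Poly → Poly
  (U ∘ₒ φ) p = app U (app φ p)

  -- exponential generating function  G_ψ(x,t) = Σ_n (ψ x^n) t^n / n!
  EGF : (Poly → Poly) → FPS₂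
  EGF ψ i n = coeff (ψ (mono n)) i * invFact n

  -- g(Q) p = Σ_j g_j Q^j p  (for a polynomial p, Q^j p = 0 once
  -- j > deg p, since a delta operator lowers degrees; the sum is taken
  -- up to the degree bound of p)
  applySeries : FPS → LinOp → Poly → FPS
  applySeries g Q p i = sumTo (suc (bound p)) (λ j → g j * coeff (iter Q j p) i)

{-# OPTIONS --safe #-}
-- Both sides are linear in p and the umbral polynomials φₙ are a triangular basis, so it is enough
-- to compare them on φₙ. There Qᵇ φₙ = n!/(n-b)! φₙ₋ᵦ for b ≤ n and Qᵇ φₙ = 0 for b > n, so the
-- coefficient of tⁿ/n! in S(x,t) G_φ(x,t) is S(x̂,Q) φₙ (x̂ to the left of Q), while by hypothesis it
-- is U φₙ. Finally, only finitely many coefficients of S = Σₖ fₖ(x) gₖ(t) act on a given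
-- coefficient of S(x̂,Q) p, and regrouping that finite sum gives Σₖ fₖ(x̂) gₖ(Q) p.

module Submission where

open import Defs
import Level
open import Data.Nat using (ℕ; zero; suc; _≤_; _<_; _∸_; _⊔_; _!; z≤n; s≤s)
import Data.Nat as ℕ
open import Data.Nat.Properties
  using (≤-refl; ≤-trans; ≤-total; ≤-pred; <⇒≤; m≤n⇒m≤1+n; m≤n⇒m<n∨m≡n;
         m≤m⊔n; m≤n⊔m; m⊔n≤o⇒m≤o; m⊔n≤o⇒n≤o; n∸n≡0; _!≢0)
open import Data.Nat.Combinatorics.Base using (_P′_; _C_)
open import Data.Nat.Combinatorics.Specification using (nP′k≡n!/[n∸k]!; [n∸k]!k!∣n!)
open import Data.Nat.Divisibility using (∣-trans; m∣m*n)
open import Data.Nat.DivMod using (m*[n/m]≡n)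
open import Data.Product using (∃; _×_; _,_; proj₁; proj₂)
open import Data.Sum using (inj₁; inj₂)
open import Relation.Binary.PropositionalEquality as ≡ using (_≡_)
open import Relation.Nullary using (¬_)

maxBelow : (ℕ → ℕ) → ℕ → ℕ
maxBelow h zero    = 0
maxBelow h (suc n) = maxBelow h n ⊔ h n

≤-maxBelow : ∀ h {n k} → k < n → h k ≤ maxBelow h n
≤-maxBelow h {suc n} (s≤s k≤n) with m≤n⇒m<n∨m≡n k≤n
... | inj₁ k<n    = ≤-trans (≤-maxBelow h k<n) (m≤m⊔n _ _)
... | inj₂ ≡.refl = m≤n⊔m _ _

[n∸k]!*nP′k≡n! : ∀ {n k} → k ≤ n → (n ∸ k) ! ℕ.* (n P′ k) ≡ n !
[n∸k]!*nP′k≡n! {n} {k} k≤n =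
  ≡.trans (≡.cong ((n ∸ k) ! ℕ.*_) (nP′k≡n!/[n∸k]! k≤n))
          (m*[n/m]≡n {{(n ∸ k) !≢0}} (∣-trans (m∣m*n (k !)) ([n∸k]!k!∣n! k≤n)))

n∸j≡1+n∸[1+j] : ∀ {j n} → j < n → n ∸ j ≡ suc (n ∸ suc j)
n∸j≡1+n∸[1+j] {zero}  {suc n} _         = ≡.refl
n∸j≡1+n∸[1+j] {suc j} {suc n} (s≤s j<n) = n∸j≡1+n∸[1+j] j<n

module Expansion {c ℓ} (𝕂 : CharZeroField c ℓ) where
  open CharZeroField 𝕂
  open Ops 𝕂
  open import Relation.Binary.Reasoning.Setoid setoid
  open import Algebra.Properties.Ring ring using (-0#≈0#)
  open import Algebra.Properties.Group +-group
    using (identityʳ-unique; //-rightDividesˡ; x≈y⇒x∙y⁻¹≈ε)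
  open import Algebra.Properties.CommutativeSemigroup +-commutativeSemigroup
    using (interchange)
  open import Algebra.Properties.CommutativeSemigroup *-commutativeSemigroup
    using (x∙yz≈y∙xz; x∙yz≈yx∙z)
  open import Algebra.Properties.Semiring.Mult semiring
    using (×1-homo-*) renaming (_×_ to _·ₙ_)

  sumTo-cong : ∀ n {a b : ℕ → Carrier} → (∀ k → k < n → a k ≈ b k) →
               sumTo n a ≈ sumTo n b
  sumTo-cong zero    eq = refl
  sumTo-cong (suc n) eq = +-cong (sumTo-cong n (λ k k<n → eq k (m≤n⇒m≤1+n k<n))) (eq n ≤-refl)

  sumTo-≈0 : ∀ n {a : ℕ → Carrier} → (∀ k → k < n → a k ≈ 0#) → sumTo n a ≈ 0#
  sumTo-≈0 zero    eq = refl
  sumTo-≈0 (suc n) eq =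
    trans (+-cong (sumTo-≈0 n (λ k k<n → eq k (m≤n⇒m≤1+n k<n))) (eq n ≤-refl)) (+-identityˡ 0#)

  sumTo-distrib-+ : ∀ n (a b : ℕ → Carrier) →
                    sumTo n (λ k → a k + b k) ≈ sumTo n a + sumTo n b
  sumTo-distrib-+ zero    a b = sym (+-identityˡ 0#)
  sumTo-distrib-+ (suc n) a b = trans (+-congʳ (sumTo-distrib-+ n a b)) (interchange _ _ _ _)

  *-distribˡ-sumTo : ∀ n x (a : ℕ → Carrier) → x * sumTo n a ≈ sumTo n (λ k → x * a k)
  *-distribˡ-sumTo zero    x a = zeroʳ x
  *-distribˡ-sumTo (suc n) x a = trans (distribˡ x _ _) (+-congʳ (*-distribˡ-sumTo n x a))

  *-distribʳ-sumTo : ∀ n x (a : ℕ → Carrier) → sumTo n a * x ≈ sumTo n (λ k → a k * x)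
  *-distribʳ-sumTo zero    x a = zeroˡ x
  *-distribʳ-sumTo (suc n) x a = trans (distribʳ x _ _) (+-congʳ (*-distribʳ-sumTo n x a))

  sumTo-comm : ∀ n m (h : ℕ → ℕ → Carrier) →
               sumTo n (λ k → sumTo m (h k)) ≈ sumTo m (λ j → sumTo n (λ k → h k j))
  sumTo-comm zero    m h = sym (sumTo-≈0 m (λ _ _ → refl))
  sumTo-comm (suc n) m h = trans (+-congʳ (sumTo-comm n m h)) (sym (sumTo-distrib-+ m _ _))

  sumTo-extend : ∀ {m n} {a : ℕ → Carrier} → m ≤ n → (∀ k → m ≤ k → a k ≈ 0#) →
                 sumTo m a ≈ sumTo n a
  sumTo-extend {n = zero}  z≤n  _    = refl
  sumTo-extend {m} {suc n} {a} m≤1+n a≈0 with m≤n⇒m<n∨m≡n m≤1+n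
  ... | inj₂ ≡.refl     = refl
  ... | inj₁ (s≤s m≤n) = begin
    sumTo m a          ≈⟨ sumTo-extend m≤n a≈0 ⟩
    sumTo n a          ≈⟨ +-identityʳ _ ⟨
    sumTo n a + 0#     ≈⟨ +-congˡ (a≈0 n m≤n) ⟨
    sumTo n a + a n    ∎

  sumTo-support : ∀ {m n} {a : ℕ → Carrier} → (∀ k → m ≤ k → a k ≈ 0#) →
                  (∀ k → n ≤ k → a k ≈ 0#) → sumTo m a ≈ sumTo n a
  sumTo-support {m} {n} a≈0 a≈0′ with ≤-total m n
  ... | inj₁ m≤n = sumTo-extend m≤n a≈0
  ... | inj₂ n≤m = sym (sumTo-extend n≤m a≈0′)

  hasSum₂-box : ∀ {F S} → HasSum₂ F S → ∀ A B → ∃ λ K → ∀ a j → a < A → j < B →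
                (∀ k → K ≤ k → F k a j ≈ 0#) × (S a j ≈ sumTo K (λ k → F k a j))
  hasSum₂-box hasSum A B = K , λ a j a<A j<B →
    let Kₐⱼ≤K = ≤-trans (≤-maxBelow (Kₐ a) j<B) (≤-maxBelow (λ a → maxBelow (Kₐ a) B) a<A)
        (_ , F≈0 , S≈sum) = hasSum a j
    in (λ k K≤k → F≈0 k (≤-trans Kₐⱼ≤K K≤k)) , trans S≈sum (sumTo-extend Kₐⱼ≤K F≈0)
    where
    Kₐ : ℕ → ℕ → ℕ
    Kₐ a j = proj₁ (hasSum a j)
    K : ℕ
    K = maxBelow (λ a → maxBelow (Kₐ a) B) A

  ι≡·ₙ1 : ∀ n → ι n ≡ n ·ₙ 1#
  ι≡·ₙ1 zero    = ≡.refl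
  ι≡·ₙ1 (suc n) = ≡.cong (1# +_) (ι≡·ₙ1 n)

  ι-* : ∀ m n → ι (m ℕ.* n) ≈ ι m * ι n
  ι-* m n rewrite ι≡·ₙ1 (m ℕ.* n) | ι≡·ₙ1 m | ι≡·ₙ1 n = ×1-homo-* m n

  ι1*x≈x : ∀ x → ι 1 * x ≈ x
  ι1*x≈x x = trans (*-congʳ (+-identityʳ 1#)) (*-identityˡ x)

  *-invFact-cancel : ∀ n x → x * invFact n * ι (n !) ≈ x
  *-invFact-cancel n x = begin
    x * invFact n * ι (n !)    ≈⟨ *-assoc x _ _ ⟩
    x * (invFact n * ι (n !))  ≈⟨ *-congˡ (*-comm _ _) ⟩
    x * (ι (n !) * invFact n)  ≈⟨ *-congˡ (inv-r _ _) ⟩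
    x * 1#                     ≈⟨ *-identityʳ x ⟩
    x                          ∎

  vanishes : ∀ p {i} → bound p ≤ i → coeff p i ≈ 0#
  vanishes p {i} = proj₂ (proj₂ p) i

  _+ₚ_ : Poly → Poly → Poly
  p +ₚ q = (λ i → coeff p i + coeff q i) , bound p ⊔ bound q , λ i ≤i →
    trans (+-cong (vanishes p (m⊔n≤o⇒m≤o _ _ ≤i)) (vanishes q (m⊔n≤o⇒n≤o _ _ ≤i))) (+-identityˡ 0#)

  -ₚ_ : Poly → Poly
  -ₚ p = (λ i → - coeff p i) , bound p , λ i ≤i → trans (-‿cong (vanishes p ≤i)) -0#≈0#

  _·ₚ_ : Carrier → Poly → Poly
  a ·ₚ p = (λ i → a * coeff p i) , bound p , λ i ≤i → trans (*-congˡ (vanishes p ≤i)) (zeroʳ a)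

  _^_ : LinOp → ℕ → LinOp
  app (Q ^ j) = iter Q j
  cong (Q ^ zero)  p q p≈q = p≈q
  cong (Q ^ suc j) p q p≈q = cong Q _ _ (cong (Q ^ j) p q p≈q)
  additive (Q ^ zero)  p q r r≈p+q = r≈p+q
  additive (Q ^ suc j) p q r r≈p+q = additive Q _ _ _ (additive (Q ^ j) p q r r≈p+q)
  homog (Q ^ zero)  a p q q≈ap = q≈ap
  homog (Q ^ suc j) a p q q≈ap = homog Q a _ _ (homog (Q ^ j) a p q q≈ap)

  record LinearFunctional : Set (c Level.⊔ ℓ) where
    field
      apply       : Poly → Carrier
      apply-+     : ∀ p q r → (∀ i → coeff r i ≈ coeff p i + coeff q i) →
                    apply r ≈ apply p + apply q
      apply-scale : ∀ a p q → (∀ i → coeff q i ≈ a * coeff p i) → apply q ≈ a * apply p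

    apply-≈0 : ∀ p → (∀ i → coeff p i ≈ 0#) → apply p ≈ 0#
    apply-≈0 p p≈0 = trans (apply-scale 0# p p (λ i → trans (p≈0 i) (sym (zeroˡ _)))) (zeroˡ _)
  open LinearFunctional

  coeffᶠ : LinOp → ℕ → LinearFunctional
  coeffᶠ U i = record
    { apply       = λ p → coeff (app U p) i
    ; apply-+     = λ p q r r≈p+q → additive U p q r r≈p+q i
    ; apply-scale = λ a p q q≈ap → homog U a p q q≈ap i
    }

  _·ᶠ_ : Carrier → LinearFunctional → LinearFunctional
  x ·ᶠ A = record
    { apply       = λ p → x * apply A p
    ; apply-+     = λ p q r r≈p+q → trans (*-congˡ (apply-+ A p q r r≈p+q)) (distribˡ x _ _)
    ; apply-scale = λ a p q q≈ap → trans (*-congˡ (apply-scale A a p q q≈ap)) (x∙yz≈y∙xz x a _)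
    }

  Σᶠ : ℕ → (ℕ → LinearFunctional) → LinearFunctional
  Σᶠ n A = record
    { apply       = λ p → sumTo n (λ k → apply (A k) p)
    ; apply-+     = λ p q r r≈p+q →
        trans (sumTo-cong n (λ k _ → apply-+ (A k) p q r r≈p+q)) (sumTo-distrib-+ n _ _)
    ; apply-scale = λ a p q q≈ap →
        trans (sumTo-cong n (λ k _ → apply-scale (A k) a p q q≈ap)) (sym (*-distribˡ-sumTo n a _))
    }

  app-≈0 : ∀ U p → (∀ i → coeff p i ≈ 0#) → ∀ i → coeff (app U p) i ≈ 0#
  app-≈0 U p p≈0 i = apply-≈0 (coeffᶠ U i) p p≈0

  -- Subtracting the multiple of Φ N that matches the coefficient of x^N lowers the support bound.
  agree-on-triangular : (Φ : ℕ → Poly) → (∀ n → ¬ (coeff (Φ n) n ≈ 0#)) →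
    (∀ n i → n < i → coeff (Φ n) i ≈ 0#) → (A A′ : LinearFunctional) →
    ∀ N → (∀ n → n < N → apply A (Φ n) ≈ apply A′ (Φ n)) →
    ∀ p → (∀ i → N ≤ i → coeff p i ≈ 0#) → apply A p ≈ apply A′ p
  agree-on-triangular Φ lead≉0 Φ-deg A A′ zero _ p p≈0 =
    trans (apply-≈0 A p (λ i → p≈0 i z≤n)) (sym (apply-≈0 A′ p (λ i → p≈0 i z≤n)))
  agree-on-triangular Φ lead≉0 Φ-deg A A′ (suc N) A≈A′ p p≈0 = begin
    apply A p                ≈⟨ apply-+ A q r p p≈q+r ⟩
    apply A q + apply A r    ≈⟨ +-cong q-agrees r-agrees ⟩
    apply A′ q + apply A′ r  ≈⟨ apply-+ A′ q r p p≈q+r ⟨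
    apply A′ p               ∎
    where
    lead a : Carrier
    lead = coeff (Φ N) N
    a = coeff p N * inv lead (lead≉0 N)

    r q : Poly
    r = a ·ₚ Φ N
    q = p +ₚ (-ₚ r)

    a*lead≈pₙ : a * lead ≈ coeff p N
    a*lead≈pₙ = begin
      coeff p N * inv lead _ * lead    ≈⟨ *-assoc _ _ _ ⟩
      coeff p N * (inv lead _ * lead)  ≈⟨ *-congˡ (*-comm _ _) ⟩
      coeff p N * (lead * inv lead _)  ≈⟨ *-congˡ (inv-r lead (lead≉0 N)) ⟩
      coeff p N * 1#                   ≈⟨ *-identityʳ _ ⟩
      coeff p N                        ∎

    p≈q+r : ∀ i → coeff p i ≈ coeff q i + coeff r i
    p≈q+r i = sym (//-rightDividesˡ (coeff r i) (coeff p i))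

    q≈0 : ∀ i → N ≤ i → coeff q i ≈ 0#
    q≈0 i N≤i with m≤n⇒m<n∨m≡n N≤i
    ... | inj₂ ≡.refl = x≈y⇒x∙y⁻¹≈ε (sym a*lead≈pₙ)
    ... | inj₁ N<i    = trans (+-cong (p≈0 i N<i) (trans (-‿cong rᵢ≈0) -0#≈0#)) (+-identityˡ 0#)
      where
      rᵢ≈0 : coeff r i ≈ 0#
      rᵢ≈0 = trans (*-congˡ (Φ-deg N i N<i)) (zeroʳ a)

    q-agrees : apply A q ≈ apply A′ q
    q-agrees = agree-on-triangular Φ lead≉0 Φ-deg A A′ N
                 (λ n n<N → A≈A′ n (m≤n⇒m≤1+n n<N)) q q≈0

    r-agrees : apply A r ≈ apply A′ r
    r-agrees = begin
      apply A r           ≈⟨ apply-scale A a (Φ N) r (λ _ → refl) ⟩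
      a * apply A (Φ N)   ≈⟨ *-congˡ (A≈A′ N ≤-refl) ⟩
      a * apply A′ (Φ N)  ≈⟨ apply-scale A′ a (Φ N) r (λ _ → refl) ⟨
      apply A′ r          ∎

  x+1≈shift : coeff (mono 1 +ₚ mono 0) ≈₁ shiftC 1# (mono 1)
  x+1≈shift i = sym (begin
    0# + _ * 0# + ι (1 C i) * pow 1# (1 ∸ i) * 1#
      ≈⟨ +-cong (trans (+-identityˡ _) (zeroʳ _)) (*-identityʳ _) ⟩
    0# + ι (1 C i) * pow 1# (1 ∸ i)  ≈⟨ +-identityˡ _ ⟩
    ι (1 C i) * pow 1# (1 ∸ i)       ≈⟨ x¹-term i ⟩
    coeff (mono 1 +ₚ mono 0) i       ∎)
    where
    x¹-term : ∀ i → ι (1 C i) * pow 1# (1 ∸ i) ≈ coeff (mono 1 +ₚ mono 0) i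
    x¹-term zero          =
      trans (*-congˡ (*-identityʳ 1#)) (trans (ι1*x≈x 1#) (sym (+-identityˡ 1#)))
    x¹-term (suc zero)    = trans (ι1*x≈x 1#) (sym (+-identityʳ 1#))
    x¹-term (suc (suc i)) = trans (zeroˡ 1#) (sym (+-identityˡ 0#))

  shiftC-constant : ∀ a r → (∀ j → 1 ≤ j → coeff r j ≈ 0#) → shiftC a r ≈₁ coeff r
  shiftC-constant a r r≈0 i =
    trans (sumTo-support {a = term} (term≈0 (λ _ → vanishes r)) (term≈0 r≈0))
          (trans (+-identityˡ _) (term₀ i))
    where
    term : ℕ → Carrier
    term j = ι (j C i) * pow a (j ∸ i) * coeff r j
    term≈0 : ∀ {m} → (∀ j → m ≤ j → coeff r j ≈ 0#) → ∀ j → m ≤ j → term j ≈ 0#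
    term≈0 r≈0 j m≤j = trans (*-congˡ (r≈0 j m≤j)) (zeroʳ _)
    term₀ : ∀ i → ι (0 C i) * pow a (0 ∸ i) * coeff r 0 ≈ coeff r i
    term₀ zero    = trans (*-congʳ (*-identityʳ _)) (ι1*x≈x _)
    term₀ (suc i) = trans (*-congʳ (zeroˡ _)) (trans (zeroˡ _) (sym (r≈0 (suc i) (s≤s z≤n))))

  -- Shift-invariance gives Q (x + 1) = E¹ (Q x) = Q x, as Q x is constant.
  shiftInvariant-annihilates-1 : ∀ Q → ShiftInvariant Q →
    (∀ i → 1 ≤ i → coeff (app Q (mono 1)) i ≈ 0#) → ∀ i → coeff (app Q (mono 0)) i ≈ 0#
  shiftInvariant-annihilates-1 Q Q-inv Qx-const i = identityʳ-unique _ _ (begin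
    coeff (app Q (mono 1)) i + coeff (app Q (mono 0)) i
      ≈⟨ additive Q (mono 1) (mono 0) (mono 1 +ₚ mono 0) (λ _ → refl) i ⟨
    coeff (app Q (mono 1 +ₚ mono 0)) i
      ≈⟨ Q-inv 1# (mono 1) (mono 1 +ₚ mono 0) x+1≈shift i ⟩
    shiftC 1# (app Q (mono 1)) i
      ≈⟨ shiftC-constant 1# (app Q (mono 1)) Qx-const i ⟩
    coeff (app Q (mono 1)) i ∎)

  -- S(x̂, Q) p with every x̂ to the left of Q, keeping only the powers Q^j with j < B.
  applySeries₂ : FPS₂ → LinOp → ℕ → Poly → FPS
  applySeries₂ S Q B p i = sumTo (suc i) (λ a → sumTo B (λ j → S a j * coeff (iter Q j p) (i ∸ a)))

  applySeries₂ᶠ : FPS₂ → LinOp → ℕ → ℕ → LinearFunctional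
  applySeries₂ᶠ S Q B i = Σᶠ (suc i) (λ a → Σᶠ B (λ j → S a j ·ᶠ coeffᶠ (Q ^ j) (i ∸ a)))

  applySeries₂-⊗ : ∀ (f g : ℕ → FPS) S Q p i K →
    (∀ a j → a < suc i → j < suc (bound p) → S a j ≈ sumTo K (λ k → f k a * g k j)) →
    applySeries₂ S Q (suc (bound p)) p i ≈ sumTo K (λ k → (f k ·₁ applySeries (g k) Q p) i)
  applySeries₂-⊗ f g S Q p i K S≈Σfg = begin
    sumTo (suc i) (λ a → sumTo B (λ j → S a j * Qʲp a j))
      ≈⟨ sumTo-cong (suc i) (λ a a≤i → sumTo-cong B (λ j j<B →
           trans (*-congʳ (S≈Σfg a j a≤i j<B)) (*-distribʳ-sumTo K _ _))) ⟩
    sumTo (suc i) (λ a → sumTo B (λ j → sumTo K (λ k → f k a * g k j * Qʲp a j)))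
      ≈⟨ sumTo-cong (suc i) (λ a _ → sumTo-comm B K _) ⟩
    sumTo (suc i) (λ a → sumTo K (λ k → sumTo B (λ j → f k a * g k j * Qʲp a j)))
      ≈⟨ sumTo-comm (suc i) K _ ⟩
    sumTo K (λ k → sumTo (suc i) (λ a → sumTo B (λ j → f k a * g k j * Qʲp a j)))
      ≈⟨ sumTo-cong K (λ k _ → sumTo-cong (suc i) (λ a _ → sym (reassoc k a))) ⟩
    sumTo K (λ k → (f k ·₁ applySeries (g k) Q p) i) ∎
    where
    B : ℕ
    B = suc (bound p)
    Qʲp : ℕ → ℕ → Carrier
    Qʲp a j = coeff (iter Q j p) (i ∸ a)
    reassoc : ∀ k a → f k a * sumTo B (λ j → g k j * Qʲp a j) ≈
                      sumTo B (λ j → f k a * g k j * Qʲp a j)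
    reassoc k a = trans (*-distribˡ-sumTo B _ _) (sumTo-cong B (λ j _ → sym (*-assoc _ _ _)))

  ·₁-applySeries-≈0 : ∀ (f g : FPS) Q p i →
    (∀ a j → a < suc i → j < suc (bound p) → f a * g j ≈ 0#) → (f ·₁ applySeries g Q p) i ≈ 0#
  ·₁-applySeries-≈0 f g Q p i fg≈0 = sumTo-≈0 (suc i) λ a a≤i →
    trans (*-distribˡ-sumTo (suc (bound p)) _ _) (sumTo-≈0 (suc (bound p)) λ j j≤deg →
      trans (sym (*-assoc _ _ _)) (trans (*-congʳ (fg≈0 a j a≤i j≤deg)) (zeroˡ _)))

  module Umbral (Q φ : LinOp) (δQ : IsDelta Q) (φ-umbral : IsUmbralOf φ Q) where
    Φ : ℕ → Poly
    Φ n = app φ (mono n)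

    Q1≈0 : ∀ i → coeff (app Q (mono 0)) i ≈ 0#
    Q1≈0 = shiftInvariant-annihilates-1 Q (proj₁ δQ) (proj₂ (proj₂ (proj₂ (proj₂ δQ))))

    Φ₀≈1 : ∀ {m} → m ≡ 0 → Φ m ≈ₚ mono 0
    Φ₀≈1 ≡.refl = proj₁ (proj₂ (proj₂ φ-umbral))

    QΦ : ∀ {m k} → m ≡ suc k → ∀ i → coeff (app Q (Φ m)) i ≈ ι m * coeff (Φ k) i
    QΦ ≡.refl = proj₂ (proj₂ (proj₂ (proj₂ φ-umbral))) _

    iter-Φ : ∀ {j n} → j ≤ n → ∀ i → coeff (iter Q j (Φ n)) i ≈ ι (n P′ j) * coeff (Φ (n ∸ j)) i
    iter-Φ {zero}      _   i = sym (ι1*x≈x _)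
    iter-Φ {suc j} {n} j<n i = begin
      coeff (app Q (iter Q j (Φ n))) i
        ≈⟨ homog Q _ (Φ (n ∸ j)) _ (iter-Φ (<⇒≤ j<n)) i ⟩
      ι (n P′ j) * coeff (app Q (Φ (n ∸ j))) i
        ≈⟨ *-congˡ (QΦ (n∸j≡1+n∸[1+j] j<n) i) ⟩
      ι (n P′ j) * (ι (n ∸ j) * coeff (Φ (n ∸ suc j)) i)
        ≈⟨ x∙yz≈yx∙z _ _ _ ⟩
      ι (n ∸ j) * ι (n P′ j) * coeff (Φ (n ∸ suc j)) i
        ≈⟨ *-congʳ (ι-* (n ∸ j) (n P′ j)) ⟨
      ι (n P′ suc j) * coeff (Φ (n ∸ suc j)) i ∎

    -- Qⁿ φₙ = n! is constant and Q kills constants.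
    iter-Φ-≈0 : ∀ {n j} → n < j → ∀ i → coeff (iter Q j (Φ n)) i ≈ 0#
    iter-Φ-≈0 {n} {suc j} (s≤s n≤j) i with m≤n⇒m<n∨m≡n n≤j
    ... | inj₁ n<j    = app-≈0 Q _ (iter-Φ-≈0 n<j) i
    ... | inj₂ ≡.refl = begin
      coeff (app Q (iter Q n (Φ n))) i      ≈⟨ homog Q (ι (n P′ n)) (mono 0) _ Qⁿφₙ≈const i ⟩
      ι (n P′ n) * coeff (app Q (mono 0)) i ≈⟨ *-congˡ (Q1≈0 i) ⟩
      ι (n P′ n) * 0#                       ≈⟨ zeroʳ _ ⟩
      0#                                    ∎
      where
      Qⁿφₙ≈const : ∀ i → coeff (iter Q n (Φ n)) i ≈ ι (n P′ n) * coeff (mono 0) i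
      Qⁿφₙ≈const i = trans (iter-Φ {n} ≤-refl i) (*-congˡ (Φ₀≈1 (n∸n≡0 n) i))

    iter-Φ-scaled : ∀ {b n} → b ≤ n → ∀ i →
      coeff (Φ (n ∸ b)) i * invFact (n ∸ b) * ι (n !) ≈ coeff (iter Q b (Φ n)) i
    iter-Φ-scaled {b} {n} b≤n i = begin
      x * invFact m * ι (n !)                ≈⟨ *-congˡ (reflexive (≡.cong ι ([n∸k]!*nP′k≡n! b≤n))) ⟨
      x * invFact m * ι (m ! ℕ.* (n P′ b))   ≈⟨ *-congˡ (ι-* (m !) (n P′ b)) ⟩
      x * invFact m * (ι (m !) * ι (n P′ b)) ≈⟨ *-assoc _ _ _ ⟨
      x * invFact m * ι (m !) * ι (n P′ b)   ≈⟨ *-congʳ (*-invFact-cancel m x) ⟩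
      x * ι (n P′ b)                         ≈⟨ *-comm _ _ ⟩
      ι (n P′ b) * x                         ≈⟨ iter-Φ b≤n i ⟨
      coeff (iter Q b (Φ n)) i               ∎
      where
      m : ℕ
      m = n ∸ b
      x : Carrier
      x = coeff (Φ m) i

    module _ (U : LinOp) (S : FPS₂) (egf : EGF (U ∘ₒ φ) ≈₂ (S ·₂ EGF (app φ))) where
      UΦ≈applySeries₂ : ∀ {n B} → n < B → ∀ i →
                        coeff (app U (Φ n)) i ≈ applySeries₂ S Q B (Φ n) i
      UΦ≈applySeries₂ {n} {B} n<B i = begin
        coeff (app U (Φ n)) i
          ≈⟨ *-invFact-cancel n _ ⟨
        coeff (app U (Φ n)) i * invFact n * ι (n !)
          ≈⟨ *-congʳ (egf i n) ⟩
        sumTo (suc i) (λ a → sumTo (suc n) (λ b → S a b * Φ/! a b)) * ι (n !)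
          ≈⟨ *-distribʳ-sumTo (suc i) _ _ ⟩
        sumTo (suc i) (λ a → sumTo (suc n) (λ b → S a b * Φ/! a b) * ι (n !))
          ≈⟨ sumTo-cong (suc i) (λ a _ → inner a) ⟩
        applySeries₂ S Q B (Φ n) i ∎
        where
        Φ/! : ℕ → ℕ → Carrier
        Φ/! a b = coeff (Φ (n ∸ b)) (i ∸ a) * invFact (n ∸ b)
        inner : ∀ a → sumTo (suc n) (λ b → S a b * Φ/! a b) * ι (n !) ≈
                      sumTo B (λ b → S a b * coeff (iter Q b (Φ n)) (i ∸ a))
        inner a = begin
          sumTo (suc n) (λ b → S a b * Φ/! a b) * ι (n !)
            ≈⟨ *-distribʳ-sumTo (suc n) _ _ ⟩
          sumTo (suc n) (λ b → S a b * Φ/! a b * ι (n !))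
            ≈⟨ sumTo-cong (suc n) (λ b b≤n →
                 trans (*-assoc _ _ _) (*-congˡ (iter-Φ-scaled (≤-pred b≤n) (i ∸ a)))) ⟩
          sumTo (suc n) (λ b → S a b * coeff (iter Q b (Φ n)) (i ∸ a))
            ≈⟨ sumTo-extend n<B (λ b n<b → trans (*-congˡ (iter-Φ-≈0 n<b (i ∸ a))) (zeroʳ _)) ⟩
          sumTo B (λ b → S a b * coeff (iter Q b (Φ n)) (i ∸ a)) ∎

      U≈applySeries₂ : ∀ {B} p → bound p < B → ∀ i → coeff (app U p) i ≈ applySeries₂ S Q B p i
      U≈applySeries₂ {B} p deg<B i =
        agree-on-triangular Φ (proj₁ φ-umbral) (proj₁ (proj₂ φ-umbral))
          (coeffᶠ U i) (applySeries₂ᶠ S Q B i) (bound p)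
          (λ n n<deg → UΦ≈applySeries₂ (≤-trans n<deg (<⇒≤ deg<B)) i) p (λ _ → vanishes p)

mainTheorem6 : ∀ {c ℓ} (𝕂 : CharZeroField c ℓ) → let open Ops 𝕂 in
    (U Q φ : LinOp) → IsDelta Q → IsUmbralOf φ Q →
    (f g : ℕ → FPS) (S : FPS₂) →
    HasSum₂ (λ k → f k ⊗ g k) S →
    EGF (U ∘ₒ φ) ≈₂ (S ·₂ EGF (app φ)) →
    (p : Poly) → HasSum₁ (λ k → f k ·₁ applySeries (g k) Q p) (coeff (app U p))
mainTheorem6 𝕂 U Q φ δQ φ-umbral f g S S≈Σf⊗g egf p i
  with Expansion.hasSum₂-box 𝕂 S≈Σf⊗g (suc i) (suc (Ops.bound 𝕂 p))
... | K , box = K , tail-≈0 , (begin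
    coeff (app U p) i                                 ≈⟨ U≈applySeries₂ U S egf p ≤-refl i ⟩
    applySeries₂ S Q (suc (bound p)) p i              ≈⟨ applySeries₂-⊗ f g S Q p i K S≈Σfg ⟩
    sumTo K (λ k → (f k ·₁ applySeries (g k) Q p) i)  ∎)
  where
  open CharZeroField 𝕂
  open Ops 𝕂
  open Expansion 𝕂
  open Umbral Q φ δQ φ-umbral
  open import Relation.Binary.Reasoning.Setoid setoid

  S≈Σfg : ∀ a j → a < suc i → j < suc (bound p) → S a j ≈ sumTo K (λ k → f k a * g k j)
  S≈Σfg a j a≤i j≤deg = proj₂ (box a j a≤i j≤deg)

  tail-≈0 : ∀ k → K ≤ k → (f k ·₁ applySeries (g k) Q p) i ≈ 0#
  tail-≈0 k K≤k = ·₁-applySeries-≈0 (f k) (g k) Q p i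
                    (λ a j a≤i j≤deg → proj₁ (box a j a≤i j≤deg) k K≤k)
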